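{- Let $p$ be a prime and $s,t\in\mathbb{Z}_p$. Then $s-t\in\mathbb{Z}$ if and only if $f_s\mathrel{E_{\mathbb{Z}}}f_t$, where $f_u(k)=v_p(k-u)$ for $k\in\mathbb{Z}$.
   Context: $\mathbb{Z}_p$ denotes the $p$-adic integers and $v_p$ the $p$-adic valuation (with $v_p(0)=\infty$). For $f,g\colon\mathbb{Z}\to\mathbb{N}\cup\{\infty\}$, $f\mathrel{E_{\mathbb{Z}}}g$ means there is $n\in\mathbb{Z}$ with $f(m)=g(m+n)$ for all $m\in\mathbb{Z}$. -}

module Defs where

open import Data.Nat as ℕ using (ℕ; zero; suc; _<_; _^_; NonZero)
open import Data.Nat.Properties using (m^n≢0)
open import Data.Integer as ℤ using (ℤ; +_)
open import Data.Integer.DivMod using (_%ℕ_)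
open import Data.Bool using (Bool; true; false; _∧_)
open import Data.Product using (∃)
open import Relation.Nullary.Decidable using (⌊_⌋)
open import Relation.Binary.PropositionalEquality using (_≡_; refl)

-- ℕ ∪ {∞} as decreasing binary sequences: seq i ≡ true iff i < value.
-- (the all-true sequence is ∞, a sequence with exactly n trues is n)
record ℕ∞ : Set where
  field
    seq : ℕ → Bool
    decreasing : ∀ i → seq (suc i) ≡ true → seq i ≡ true
open ℕ∞ public

_≈∞_ : ℕ∞ → ℕ∞ → Set
x ≈∞ y = ∀ i → seq x i ≡ seq y i

-- p-adic integers as the inverse limit of ℤ/p^n ℤ:
-- compatible sequences of residues (res n ∈ {0,…,p^n - 1}).
record ℤₚ (p : ℕ) .{{_ : NonZero p}} : Set where
  field
    res : ℕ → ℕ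
    res< : ∀ n → res n < p ^ n
    coh : ∀ n → ℕ._%_ (res (suc n)) (p ^ n) {{m^n≢0 p n}} ≡ res n
open ℤₚ public

_≈ₚ_ : ∀ {p} .{{_ : NonZero p}} → ℤₚ p → ℤₚ p → Set
_≈ₚ_ {p} s t = ∀ n → res s n ≡ res t n

DiffInℤ : ∀ {p} .{{_ : NonZero p}} → ℤₚ p → ℤₚ p → Set
DiffInℤ {p} s t = ∃ λ (z : ℤ) → ∀ n →
  res s n ≡ _%ℕ_ (+ res t n ℤ.+ z) (p ^ n) {{m^n≢0 p n}}

congMod : ∀ {p} .{{_ : NonZero p}} → ℤ → ℤₚ p → ℕ → Bool
congMod {p} k u n = ⌊ _%ℕ_ k (p ^ n) {{m^n≢0 p n}} ℕ.≟ res u n ⌋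

-- sequence i ↦ [p^(i+1) ∣ k - u]  (made decreasing by construction)
valSeq : ∀ {p} .{{_ : NonZero p}} → ℤ → ℤₚ p → ℕ → Bool
valSeq k u zero = congMod k u 1
valSeq k u (suc i) = valSeq k u i ∧ congMod k u (suc (suc i))

private
  ∧-true : ∀ a b → a ∧ b ≡ true → a ≡ true
  ∧-true true b _ = refl

vₚ-diff : ∀ {p} .{{_ : NonZero p}} → ℤ → ℤₚ p → ℕ∞
vₚ-diff k u = record
  { seq = valSeq k u
  ; decreasing = λ i e → ∧-true (valSeq k u i) _ e }

f[_] : ∀ {p} .{{_ : NonZero p}} → ℤₚ p → ℤ → ℕ∞
f[ u ] k = vₚ-diff k u

_E-ℤ_ : (ℤ → ℕ∞) → (ℤ → ℕ∞) → Set
f E-ℤ g = ∃ λ (n : ℤ) → ∀ (m : ℤ) → f m ≈∞ g (m ℤ.+ n)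

{-# OPTIONS --safe #-}
module Submission where

-- For k ∈ ℤ, f_u(k) ≥ n says k ≡ u (mod p^n). If s = t + z, then k ≡ s and k - z ≡ t are
-- equivalent modulo every p^n, so f_s(k) = f_t(k - z). Conversely, if f_s(m) = f_t(m + n) for
-- all m, evaluate at the integer representative m of s modulo p^(i+1): then f_t(m + n) ≥ i + 1,
-- i.e. s ≡ t - n (mod p^(i+1)) for every i, so s = t - n.

open import Defs
open import Data.Nat using (ℕ; NonZero)
open import Data.Nat.Primality using (Prime)
open import Function.Bundles using (_⇔_; mk⇔; module Equivalence)

open import Data.Bool.Base using (true; _∧_)
open import Data.Bool.Properties using (T-≡)
open import Data.Nat.Base as ℕ using (zero; suc; _<_; _≤′_; ≤′-refl; ≤′-step; _^_; _%_)
import Data.Nat.Properties as ℕ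
import Data.Nat.DivMod as ℕ
import Data.Nat.Divisibility as ℕ
open import Data.Integer.Base as ℤ using (ℤ; +_; _+_; _-_; -_; _*_)
open import Data.Integer.DivMod using (_%ℕ_; _/ℕ_; n%ℕd<d; a≡a%ℕn+[a/ℕn]*n)
open import Data.Integer.Divisibility.Signed
  using (_∣_; divides; ∣⇒∣ᵤ; ∣m∣n⇒∣m+n; ∣m+n∣n⇒∣m; ∣m∣n⇒∣m-n)
open import Data.Integer.Properties
  using (+-injective; m-n≡m⊖n; ∣m⊝n∣≤m⊔n; ∣i∣≡0⇒i≡0; i-j≡0⇒i≡j; +-minus-telescope)
open import Data.Integer.Tactic.RingSolver using (solve-∀)
open import Data.Product.Base using (_,_)
open import Function.Base using (_∘_)
import Function.Properties.Equivalence as ⇔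
open import Function.Related.Propositional using (module EquationalReasoning; equivalence)
open import Relation.Nullary.Decidable using (does; isYes; isYes≗does; does-⇔; toWitness; fromWitness)
open import Relation.Binary.PropositionalEquality
  using (_≡_; sym; trans; cong; cong₂; subst; module ≡-Reasoning)

d∣n∧n<d⇒n≡0 : ∀ {d n} .{{_ : NonZero d}} → d ℕ.∣ n → n < d → n ≡ 0
d∣n∧n<d⇒n≡0 {d} {n} d∣n n<d = trans (sym (ℕ.m<n⇒m%n≡m n<d)) (ℕ.n∣m⇒m%n≡0 n d d∣n)

d∣m-n⇒m≡n : ∀ {d m n} .{{_ : NonZero d}} → m < d → n < d → + d ∣ + m - + n → m ≡ n
d∣m-n⇒m≡n {d} {m} {n} m<d n<d d∣m-n =
  +-injective (i-j≡0⇒i≡j _ _ (∣i∣≡0⇒i≡0 (d∣n∧n<d⇒n≡0 (∣⇒∣ᵤ d∣m-n) ∣m-n∣<d)))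
  where
  ∣m-n∣<d : ℤ.∣ + m - + n ∣ < d
  ∣m-n∣<d = subst (_< d) (cong ℤ.∣_∣ (sym (m-n≡m⊖n m n)))
                  (ℕ.≤-<-trans (∣m⊝n∣≤m⊔n m n) (ℕ.⊔-lub m<d n<d))

d∣i-i%ℕd : ∀ i d .{{_ : NonZero d}} → + d ∣ i - + (i %ℕ d)
d∣i-i%ℕd i d = divides (i /ℕ d) (begin
  i - + r                    ≡⟨ cong (_- + r) (a≡a%ℕn+[a/ℕn]*n i d) ⟩
  (+ r + i /ℕ d * + d) - + r ≡⟨ [m+n]-m≡n (+ r) (i /ℕ d * + d) ⟩
  i /ℕ d * + d               ∎)
  where
  open ≡-Reasoning
  r = i %ℕ d
  [m+n]-m≡n : ∀ m n → (m + n) - m ≡ n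
  [m+n]-m≡n = solve-∀

%ℕ≡⇔∣- : ∀ i {d r} .{{_ : NonZero d}} → r < d → (i %ℕ d ≡ r ⇔ (+ d ∣ i - + r))
%ℕ≡⇔∣- i {d} {r} r<d = mk⇔
  (λ i%d≡r → subst (λ r → + d ∣ i - + r) i%d≡r (d∣i-i%ℕd i d))
  (λ d∣i-r → d∣m-n⇒m≡n (n%ℕd<d i d) r<d
    (subst (+ d ∣_) ([i-m]-[i-n]≡n-m i (+ r) _) (∣m∣n⇒∣m-n d∣i-r (d∣i-i%ℕd i d))))
  where
  [i-m]-[i-n]≡n-m : ∀ i m n → (i - m) - (i - n) ≡ n - m
  [i-m]-[i-n]≡n-m = solve-∀

∣j-k⇒[∣i-j⇔∣i-k] : ∀ {d j k} → d ∣ j - k → ∀ i → ((d ∣ i - j) ⇔ (d ∣ i - k))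
∣j-k⇒[∣i-j⇔∣i-k] {d} {j} {k} d∣j-k i = mk⇔
  (λ d∣i-j → subst (d ∣_) (+-minus-telescope i j k) (∣m∣n⇒∣m+n d∣i-j d∣j-k))
  (λ d∣i-k → ∣m+n∣n⇒∣m (subst (d ∣_) (sym (+-minus-telescope i j k)) d∣i-k) d∣j-k)

%ℕ-shift : ∀ {d a b} .{{_ : NonZero d}} z → a < d → b < d → a ≡ (+ b + z) %ℕ d →
           ∀ i → (i %ℕ d ≡ a ⇔ (i - z) %ℕ d ≡ b)
%ℕ-shift {d} {a} {b} z a<d b<d a≡b+z i = begin
  i %ℕ d ≡ a             ∼⟨ %ℕ≡⇔∣- i a<d ⟩
  + d ∣ i - + a          ∼⟨ ⇔.sym (∣j-k⇒[∣i-j⇔∣i-k] d∣b+z-a i) ⟩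
  + d ∣ i - (+ b + z)    ≡⟨ cong (+ d ∣_) (i-[m+n]≡[i-n]-m i (+ b) z) ⟩
  + d ∣ (i - z) - + b    ∼⟨ ⇔.sym (%ℕ≡⇔∣- (i - z) b<d) ⟩
  (i - z) %ℕ d ≡ b       ∎
  where
  open EquationalReasoning {k = equivalence}
  d∣b+z-a : + d ∣ (+ b + z) - + a
  d∣b+z-a = Equivalence.to (%ℕ≡⇔∣- (+ b + z) a<d) (sym a≡b+z)
  i-[m+n]≡[i-n]-m : ∀ i m n → i - (m + n) ≡ (i - n) - m
  i-[m+n]≡[i-n]-m = solve-∀

∧≡true⇒ʳ : ∀ x {y} → x ∧ y ≡ true → y ≡ true
∧≡true⇒ʳ true y≡true = y≡true

p^m∣p^n : ∀ p {m n} → m ≤′ n → p ^ m ℕ.∣ p ^ n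
p^m∣p^n p ≤′-refl = ℕ.∣-refl
p^m∣p^n p (≤′-step m≤′n) = ℕ.∣-trans (p^m∣p^n p m≤′n) (ℕ.n∣m*n p)

module _ {p : ℕ} .{{_ : NonZero p}} where

  infixl 7 _%p^_
  _%p^_ : ℤ → ℕ → ℕ
  k %p^ n = _%ℕ_ k (p ^ n) {{ℕ.m^n≢0 p n}}

  congMod≡true⇔ : ∀ k (u : ℤₚ p) n → (congMod k u n ≡ true ⇔ k %p^ n ≡ res u n)
  congMod≡true⇔ k u n = ⇔.trans (⇔.sym T-≡) (mk⇔ toWitness (fromWitness {a? = k≟u}))
    where k≟u = k %p^ n ℕ.≟ res u n

  congMod-cong : ∀ {k k′} {u u′ : ℤₚ p} n →
                 (k %p^ n ≡ res u n ⇔ k′ %p^ n ≡ res u′ n) → congMod k u n ≡ congMod k′ u′ n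
  congMod-cong {k} {k′} {u} {u′} n k≡u⇔k′≡u′ = begin
    isYes k≟u   ≡⟨ isYes≗does k≟u ⟩
    does k≟u    ≡⟨ does-⇔ k≡u⇔k′≡u′ k≟u k′≟u′ ⟩
    does k′≟u′  ≡⟨ isYes≗does k′≟u′ ⟨
    isYes k′≟u′ ∎
    where
    open ≡-Reasoning
    k≟u = k %p^ n ℕ.≟ res u n
    k′≟u′ = k′ %p^ n ℕ.≟ res u′ n

  valSeq-cong : ∀ {k k′} {u u′ : ℤₚ p} → (∀ n → congMod k u n ≡ congMod k′ u′ n) →
                ∀ i → valSeq k u i ≡ valSeq k′ u′ i
  valSeq-cong congMod≡ zero = congMod≡ 1
  valSeq-cong congMod≡ (suc i) = cong₂ _∧_ (valSeq-cong congMod≡ i) (congMod≡ (suc (suc i)))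

  valSeq⇒congMod : ∀ k (u : ℤₚ p) i → valSeq k u i ≡ true → congMod k u (suc i) ≡ true
  valSeq⇒congMod k u zero v = v
  valSeq⇒congMod k u (suc i) v = ∧≡true⇒ʳ (valSeq k u i) v

  congMod⇒valSeq : ∀ k (u : ℤₚ p) i → (∀ {j} → j ≤′ suc i → congMod k u j ≡ true) →
                   valSeq k u i ≡ true
  congMod⇒valSeq k u zero k≡u = k≡u ≤′-refl
  congMod⇒valSeq k u (suc i) k≡u = cong₂ _∧_ (congMod⇒valSeq k u i (k≡u ∘ ≤′-step)) (k≡u ≤′-refl)

  res-%p^ : (u : ℤₚ p) {j k : ℕ} → j ≤′ k → + res u k %p^ j ≡ res u j
  res-%p^ u {j} ≤′-refl = ℕ.m<n⇒m%n≡m {{ℕ.m^n≢0 p j}} (res< u j)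
  res-%p^ u {j} (≤′-step {k} j≤′k) = begin
    res u (suc k) % p ^ j          ≡⟨ ℕ.m∣n⇒o%n%m≡o%m (p ^ j) (p ^ k) _ (p^m∣p^n p j≤′k) ⟨
    res u (suc k) % p ^ k % p ^ j  ≡⟨ cong (_% p ^ j) (coh u k) ⟩
    res u k % p ^ j                ≡⟨ res-%p^ u j≤′k ⟩
    res u j                        ∎
    where
    open ≡-Reasoning
    instance
      p^j≢0 = ℕ.m^n≢0 p j
      p^k≢0 = ℕ.m^n≢0 p k

  valSeq-res≡true : (u : ℤₚ p) → ∀ i → valSeq (+ res u (suc i)) u i ≡ true
  valSeq-res≡true u i = congMod⇒valSeq _ u i λ {j} j≤′1+i →
    Equivalence.from (congMod≡true⇔ (+ res u (suc i)) u j) (res-%p^ u j≤′1+i)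

  DiffInℤ⇒E-ℤ : {s t : ℤₚ p} → DiffInℤ s t → f[ s ] E-ℤ f[ t ]
  DiffInℤ⇒E-ℤ {s} {t} (z , s≡t+z) = - z , λ k → valSeq-cong λ n →
    congMod-cong {k} {k - z} {s} {t} n
      (%ℕ-shift {{ℕ.m^n≢0 p n}} z (res< s n) (res< t n) (s≡t+z n) k)

  E-ℤ⇒DiffInℤ : {s t : ℤₚ p} → f[ s ] E-ℤ f[ t ] → DiffInℤ s t
  E-ℤ⇒DiffInℤ {s} {t} (n , fs≈ft) = - n , λ k →
    sym (Equivalence.to
      (%ℕ-shift {{ℕ.m^n≢0 p k}} n (res< t k) (res< s k) (sym (s+n≡t k)) (+ res t k))
      (res-%p^ t ≤′-refl))
    where
    s+n≡t : ∀ k → (+ res s k + n) %p^ k ≡ res t k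
    s+n≡t zero = trans (ℕ.n<1⇒n≡0 (n%ℕd<d (+ res s 0 + n) 1)) (sym (ℕ.n<1⇒n≡0 (res< t 0)))
    s+n≡t (suc i) = Equivalence.to (congMod≡true⇔ (+ res s (suc i) + n) t (suc i))
      (valSeq⇒congMod _ t i (trans (sym (fs≈ft (+ res s (suc i)) i)) (valSeq-res≡true s i)))

lemma6p4 : (p : ℕ) .{{_ : NonZero p}} → Prime p → (s t : ℤₚ p) →
    DiffInℤ s t ⇔ (f[ s ] E-ℤ f[ t ])
lemma6p4 p _ s t = mk⇔ DiffInℤ⇒E-ℤ E-ℤ⇒DiffInℤ
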